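{- For every $s_{\mathcal{D}}\in\mathcal{S}_T$, the set $J(s_{\mathcal{D}})$ is biclosed. In fact, no two elements of $J(s_{\mathcal{D}})$ are composable.
   Context: Let $T$ be a finite tree embedded in a disk so that exactly its leaves lie on the boundary, with every non-leaf vertex of degree at least $3$; the embedding gives a cyclic order of edges at each vertex. A segment is an acyclic path $(v_1,\dots,v_n)$, $n\ge2$, of pairwise distinct consecutive-adjacent vertices such that for each $1\le j\le n-2$ the edge $\{v_{j+1},v_{j+2}\}$ is immediately clockwise or counterclockwise from $\{v_j,v_{j+1}\}$ at $v_{j+1}$; $\mathrm{Seg}(T)$ is the set of segments. For segments $s_1=(v_1,\dots,v_k)$, $s_2=(v_k,\dots,v_n)$ sharing only $v_k$, $s_1\circ s_2=(v_1,\dots,v_n)$; they are composable if this is a segment. $B\subseteq\mathrm{Seg}(T)$ is closed if it contains $s_1\circ s_2$ for all composable $s_1,s_2\in B$, biclosed if $B$ and its complement are closed. A split of a segment $t$ is a proper subsegment of $t$ sharing an endpoint with $t$; a break of $[a,c]$ is a pair $\{[a,b],[b,c]\}$ with $b$ a vertex of $[a,c]$ strictly between $a$ and $c$. $\mathcal{S}_T$ is the set of labels $s_{\mathcal{D}}=(s,\mathcal{D})$ with $s\in\mathrm{Seg}(T)$ having $m$ breaks and $\mathcal{D}$ a set of $m$ splits of $s$ no two in the same break. For $s_{\mathcal{D}}\in\mathcal{S}_T$, $J(s_{\mathcal{D}}):=\{s\}\sqcup\mathcal{D}\sqcup\bigcup_{t\in\mathcal{D}}S(t)$, where $S(t)$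 is the set of splits $s'$ of $t$ such that $s'$ is not a split of $s$ and $s'$ is not composable with any segment of $\mathcal{D}$. -}

module Defs where

open import Data.Nat using (ℕ; suc; _≤_; _<_; _+_; _∸_)
open import Data.Fin using (Fin)
open import Data.List using (List; []; _∷_; _++_; _∷ʳ_; take; drop; reverse; length)
open import Data.List.Membership.Propositional using (_∈_; _∉_)
open import Data.List.Relation.Unary.All using (All)
open import Data.List.Relation.Unary.Any using (Any)
open import Data.List.Relation.Unary.AllPairs using (AllPairs)
open import Data.List.Relation.Unary.Unique.Propositional using (Unique)
open import Data.List.Relation.Unary.Linked using (Linked)
open import Data.Product using (Σ; _×_; ∃)
open import Data.Sum using (_⊎_)
open import Data.Empty using (⊥)
open import Data.Unit using (⊤)
open import Relation.Binary.PropositionalEquality using (_≡_)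
open import Relation.Nullary using (¬_)

Consec : {A : Set} → List A → A → A → Set
Consec (a ∷ b ∷ r) x y = (x ≡ a × y ≡ b) ⊎ Consec (b ∷ r) x y
Consec _ _ _ = ⊥

CycNext : {A : Set} → List A → A → A → Set
CycNext L x y = Consec (L ++ take 1 L) x y

CycAdjacent : {A : Set} → List A → A → A → Set
CycAdjacent L x y = CycNext L x y ⊎ CycNext L y x

-- Plane trees (trees with a rotation system = embedding in a disk with
-- the leaves on the boundary), every non-leaf vertex of degree ≥ 3.

record PlaneTree (n : ℕ) : Set where
  field
    -- neighbours of each vertex, listed in clockwise cyclic order
    nbrs      : Fin n → List (Fin n)
    nonempty  : 1 ≤ n
    nbrs-uniq : ∀ v → Unique (nbrs v)
    loopless  : ∀ v → v ∉ nbrs v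
    symmetric : ∀ u v → v ∈ nbrs u → u ∈ nbrs v
  Adj : Fin n → Fin n → Set
  Adj u v = v ∈ nbrs u
  field
    connected : ∀ u v → u ≡ v ⊎ ∃ λ p → Linked Adj (u ∷ p ∷ʳ v)
    acyclic   : ∀ v rest → 2 ≤ length rest → Unique (v ∷ rest)
                  → ¬ Linked Adj (v ∷ rest ∷ʳ v)
    degree    : ∀ v → length (nbrs v) ≡ 1 ⊎ 3 ≤ length (nbrs v)

-- Segments.  A segment is a vertex sequence; (v₁,…,vₙ) and (vₙ,…,v₁)
-- denote the same segment.

SameSeg : {A : Set} → List A → List A → Set
SameSeg x y = x ≡ y ⊎ x ≡ reverse y

module _ {n : ℕ} (T : PlaneTree n) where
  open PlaneTree T

  Turns : List (Fin n) → Set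
  Turns (x ∷ y ∷ z ∷ r) = CycAdjacent (nbrs y) x z × Turns (y ∷ z ∷ r)
  Turns _ = ⊤

  IsSeg : List (Fin n) → Set
  IsSeg s = 2 ≤ length s × Unique s × Linked Adj s × Turns s

  -- s₁ = a₀ ∷ʳ v and s₂ = v ∷ b₀ are composable (s₁ ∘ s₂ = a₀ ++ v ∷ b₀)
  ComposableAt : List (Fin n) → Fin n → List (Fin n) → Set
  ComposableAt a₀ v b₀ =
    IsSeg (a₀ ∷ʳ v) × IsSeg (v ∷ b₀)
    × (∀ w → w ∈ a₀ ∷ʳ v → w ∈ v ∷ b₀ → w ≡ v)
    × IsSeg (a₀ ++ v ∷ b₀)

  Composable : List (Fin n) → List (Fin n) → Set
  Composable x y = Σ (List (Fin n)) λ a₀ → Σ (Fin n) λ v → Σ (List (Fin n)) λ b₀ →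
    SameSeg x (a₀ ∷ʳ v) × SameSeg y (v ∷ b₀) × ComposableAt a₀ v b₀

  -- a set of segments is a predicate; membership is up to reversal
  Mem : (List (Fin n) → Set) → List (Fin n) → Set
  Mem B x = B x ⊎ B (reverse x)

  Closed : (List (Fin n) → Set) → Set
  Closed B = ∀ a₀ v b₀ → ComposableAt a₀ v b₀
    → Mem B (a₀ ∷ʳ v) → Mem B (v ∷ b₀) → Mem B (a₀ ++ v ∷ b₀)

  Compl : (List (Fin n) → Set) → List (Fin n) → Set
  Compl B x = IsSeg x × ¬ Mem B x

  Biclosed : (List (Fin n) → Set) → Set
  Biclosed B = Closed B × Closed (Compl B)

-- x is a split of t: a proper subsegment of t sharing an endpoint with t
Split : {A : Set} → List A → List A → Set
Split t x = Σ ℕ λ i → 2 ≤ i × i < length t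
  × (SameSeg x (take i t) ⊎ SameSeg x (take i (reverse t)))

-- {d , e} is the break {[a,b],[b,c]} of t at its (i+1)-st vertex b
-- (0-indexed position i, strictly between the endpoints)
SameBreak : {A : Set} → List A → List A → List A → Set
SameBreak t d e = Σ ℕ λ i → 1 ≤ i × i + 2 ≤ length t
  × ((SameSeg d (take (suc i) t) × SameSeg e (drop i t))
     ⊎ (SameSeg e (take (suc i) t) × SameSeg d (drop i t)))

numBreaks : {A : Set} → List A → ℕ
numBreaks t = length t ∸ 2

module _ {n : ℕ} (T : PlaneTree n) where

  -- (s , D) ∈ 𝒮_T ; D is a finite set of splits represented as a
  -- duplicate-free (up to reversal) list
  IsLabel : List (Fin n) → List (List (Fin n)) → Set
  IsLabel s D = IsSeg T s × All (Split s) D × length D ≡ numBreaks s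
    × AllPairs (λ d e → ¬ SameSeg d e × ¬ SameBreak s d e) D

  SJ : List (Fin n) → List (List (Fin n)) → List (Fin n) → List (Fin n) → Set
  SJ s D t x = Split t x × ¬ Split s x × All (λ d → ¬ Composable T x d) D

  J : List (Fin n) → List (List (Fin n)) → List (Fin n) → Set
  J s D x = SameSeg x s ⊎ Any (SameSeg x) D ⊎ Any (λ t → SJ s D t x) D

module Submission where

-- Number the vertices of s = (s₀ , … , s_ℓ) and write [i , k] for its
-- subsegment from position i to position k.  Every split of s is a head [0 , p]
-- or a tail [p , ℓ] with 0 < p < ℓ, and these two form the break at p.  D holds
-- ℓ - 1 splits, pairwise distinct and in distinct breaks, so "split ↦ p" is
-- injective into the ℓ - 1 interior positions, hence onto: each interior p
-- carries exactly one mark, a head mark ([0 , p] ∈ D) or a tail mark ([p , ℓ] ∈ D).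
-- J(s_D) is then exactly the set of intervals [i , k] with i = 0 or i tail-marked,
-- and k = ℓ or k head-marked.  Composable intervals meet at an interior endpoint,
-- which would carry both marks; so no two elements of J compose, and J is closed
-- vacuously.  Its complement is closed: cutting [i , k] ∈ J at p, a head mark at
-- p puts [i , p] in J and a tail mark puts [p , k] in J.

open import Defs
open import Data.Nat using (ℕ; zero; suc; _+_; _∸_; _≤_; _<_; z≤n; s≤s; _≟_)
open import Data.Nat.Properties
open import Data.Fin using (Fin)
open import Data.List using (List; []; _∷_; _++_; _∷ʳ_; take; drop; reverse; length; map)
open import Data.List.Properties
  using (∷-injectiveˡ; ∷-injectiveʳ; map-++; reverse-++; reverse-involutive; unfold-reverse;
         ∷ʳ-injectiveʳ; ∷ʳ-++; length-++; length-reverse; length-map)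
open import Data.List.Membership.Propositional using (_∈_; find; lose)
open import Data.List.Membership.Propositional.Properties using (∈-map⁺; ∈-map⁻)
open import Data.List.Relation.Unary.All as All using (All; []; _∷_)
import Data.List.Relation.Unary.All.Properties as Allₚ
open import Data.List.Relation.Unary.Any using (Any; here; there)
import Data.List.Relation.Unary.Any.Properties as Anyₚ
open import Data.List.Relation.Unary.AllPairs using (AllPairs; []; _∷_)
import Data.List.Relation.Unary.AllPairs.Properties as AllPairsₚ
open import Data.List.Relation.Unary.Unique.Propositional using (Unique)
import Data.List.Relation.Unary.Unique.Propositional.Properties as Uniqueₚ
open import Data.List.Relation.Unary.Linked as Linked using (Linked; []; [-]; _∷_)
open import Data.Product using (Σ; _×_; _,_; proj₁; proj₂)
open import Data.Sum using (_⊎_; inj₁; inj₂; [_,_]′)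
open import Data.Empty using (⊥; ⊥-elim)
open import Data.Unit using (⊤; tt)
open import Relation.Binary.PropositionalEquality hiding (J)
open import Relation.Nullary using (¬_; yes; no)
open import Data.List.Membership.DecPropositional _≟_ using (_∈?_)

range : ℕ → ℕ → List ℕ
range i zero    = []
range i (suc m) = i ∷ range (suc i) m

nth : {A : Set} → A → List A → ℕ → A
nth d []       p       = d
nth d (x ∷ xs) zero    = x
nth d (x ∷ xs) (suc p) = nth d xs p

module _ {A : Set} (d : A) where

  nth-range-suc : ∀ (x : A) xs i m → map (nth d (x ∷ xs)) (range (suc i) m) ≡ map (nth d xs) (range i m)
  nth-range-suc x xs i zero    = refl
  nth-range-suc x xs i (suc m) = cong (nth d xs i ∷_) (nth-range-suc x xs (suc i) m)

  nth-range-id : ∀ (xs : List A) → xs ≡ map (nth d xs) (range 0 (length xs))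
  nth-range-id []       = refl
  nth-range-id (x ∷ xs) = cong (x ∷_) (trans (nth-range-id xs) (sym (nth-range-suc x xs 0 (length xs))))

  nth-∈ : ∀ xs p → p < length xs → nth d xs p ∈ xs
  nth-∈ (x ∷ xs) zero    _        = here refl
  nth-∈ (x ∷ xs) (suc p) (s≤s lt) = there (nth-∈ xs p lt)

  nth-injective : ∀ xs p q → Unique xs → p < length xs → q < length xs → nth d xs p ≡ nth d xs q → p ≡ q
  nth-injective (x ∷ xs) zero    zero    _       _        _        _ = refl
  nth-injective (x ∷ xs) zero    (suc q) (h ∷ _) _        (s≤s lq) e = ⊥-elim (All.lookup h (nth-∈ xs q lq) e)
  nth-injective (x ∷ xs) (suc p) zero    (h ∷ _) (s≤s lp) _        e = ⊥-elim (All.lookup h (nth-∈ xs p lp) (sym e))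
  nth-injective (x ∷ xs) (suc p) (suc q) (_ ∷ u) (s≤s lp) (s≤s lq) e = cong suc (nth-injective xs p q u lp lq e)

∈-range⁻ : ∀ i m p → p ∈ range i m → i ≤ p × p < i + m
∈-range⁻ i (suc m) p (here refl) = ≤-refl , subst (i <_) (sym (+-suc i m)) (s≤s (m≤m+n i m))
∈-range⁻ i (suc m) p (there pm) with ∈-range⁻ (suc i) m p pm
... | i<p , p<i+m = <⇒≤ i<p , subst (p <_) (sym (+-suc i m)) p<i+m

∈-range⁺ : ∀ i m p → i ≤ p → p < i + m → p ∈ range i m
∈-range⁺ i zero    p i≤p p<i = ⊥-elim (<-irrefl refl (≤-trans p<i (subst (_≤ p) (sym (+-identityʳ i)) i≤p)))
∈-range⁺ i (suc m) p i≤p p<i with i ≟ p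
... | yes refl = here refl
... | no  i≢p  = there (∈-range⁺ (suc i) m p (≤∧≢⇒< i≤p i≢p) (subst (p <_) (+-suc i m) p<i))

range-+ : ∀ a m k → range a (m + k) ≡ range a m ++ range (a + m) k
range-+ a zero    k = cong (λ z → range z k) (sym (+-identityʳ a))
range-+ a (suc m) k = cong (a ∷_) (trans (range-+ (suc a) m k)
                                          (cong (λ z → range (suc a) m ++ range z k) (sym (+-suc a m))))

take-map-range : ∀ {A : Set} (f : ℕ → A) a m k → take m (map f (range a (m + k))) ≡ map f (range a m)
take-map-range f a zero    k = refl
take-map-range f a (suc m) k = cong (f a ∷_) (take-map-range f (suc a) m k)

drop-map-range : ∀ {A : Set} (f : ℕ → A) a q k → drop q (map f (range a (q + k))) ≡ map f (range (a + q) k)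
drop-map-range f a zero    k = cong (λ z → map f (range z k)) (sym (+-identityʳ a))
drop-map-range f a (suc q) k = trans (drop-map-range f (suc a) q k) (cong (λ z → map f (range z k)) (sym (+-suc a q)))

length-range : ∀ a m → length (range a m) ≡ m
length-range a zero    = refl
length-range a (suc m) = cong suc (length-range (suc a) m)

take-length-++ : ∀ {A : Set} (xs ys : List A) → take (length xs) (xs ++ ys) ≡ xs
take-length-++ []       ys = refl
take-length-++ (x ∷ xs) ys = cong (x ∷_) (take-length-++ xs ys)

++-injective : ∀ {A : Set} (a a' b b' : List A) → a ++ b ≡ a' ++ b' → length a ≡ length a' → a ≡ a' × b ≡ b'
++-injective []      []        b b' e _ = refl , e
++-injective (x ∷ a) (x' ∷ a') b b' e l with ++-injective a a' b b' (∷-injectiveʳ e) (suc-injective l)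
... | a≡a' , b≡b' = cong₂ _∷_ (∷-injectiveˡ e) a≡a' , b≡b'

reverse-∷ʳ : ∀ {A : Set} (xs : List A) v → reverse (xs ∷ʳ v) ≡ v ∷ reverse xs
reverse-∷ʳ xs v = reverse-++ xs (v ∷ [])

reverse-around : ∀ {A : Set} (a₀ : List A) v b₀ → reverse (a₀ ++ v ∷ b₀) ≡ reverse b₀ ++ v ∷ reverse a₀
reverse-around a₀ v b₀ =
  trans (reverse-++ a₀ (v ∷ b₀)) (trans (cong (_++ reverse a₀) (unfold-reverse v b₀)) (∷ʳ-++ (reverse b₀) v (reverse a₀)))

∈-reverse-≡ : ∀ {A : Set} {w : A} {xs ys} → reverse xs ≡ ys → w ∈ ys → w ∈ xs
∈-reverse-≡ refl m = Anyₚ.reverse⁻ m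

module _ {A : Set} where

  sameSeg-sym : {x y : List A} → SameSeg x y → SameSeg y x
  sameSeg-sym (inj₁ e) = inj₁ (sym e)
  sameSeg-sym {x} {y} (inj₂ e) = inj₂ (trans (sym (reverse-involutive y)) (cong reverse (sym e)))

  sameSeg-trans : {x y z : List A} → SameSeg x y → SameSeg y z → SameSeg x z
  sameSeg-trans (inj₁ e) (inj₁ f) = inj₁ (trans e f)
  sameSeg-trans (inj₁ e) (inj₂ f) = inj₂ (trans e f)
  sameSeg-trans (inj₂ e) (inj₁ f) = inj₂ (trans e (cong reverse f))
  sameSeg-trans {z = z} (inj₂ e) (inj₂ f) = inj₁ (trans e (trans (cong reverse f) (reverse-involutive z)))

  sameSeg-reverse : (x : List A) → SameSeg x (reverse x)
  sameSeg-reverse x = inj₂ (sym (reverse-involutive x))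

  sameSeg-reverseʳ : {x y : List A} → SameSeg x (reverse y) → SameSeg x y
  sameSeg-reverseʳ {y = y} h = sameSeg-trans h (sameSeg-sym (sameSeg-reverse y))

  sameSeg-∈ : {x y : List A} {w : A} → SameSeg x y → w ∈ y → w ∈ x
  sameSeg-∈ (inj₁ refl) m = m
  sameSeg-∈ (inj₂ refl) m = Anyₚ.reverse⁺ m

  sameSeg-length : {x y : List A} → SameSeg x y → length x ≡ length y
  sameSeg-length (inj₁ refl) = refl
  sameSeg-length {y = y} (inj₂ refl) = length-reverse y

replace : ℕ → ℕ → ℕ → ℕ
replace N x y with y ≟ N
... | yes _ = x
... | no  _ = y

replace-< : ∀ N x y → x < N → y < suc N → replace N x y < N
replace-< N x y x<N y≤N with y ≟ N
... | yes _   = x<N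
... | no  y≢N = ≤∧≢⇒< (≤-pred y≤N) y≢N

replace-injective : ∀ N x y y' → y ≢ x → y' ≢ x → y ≢ y' → replace N x y ≢ replace N x y'
replace-injective N x y y' y≢x y'≢x y≢y' with y ≟ N | y' ≟ N
... | yes e | yes e' = ⊥-elim (y≢y' (trans e (sym e')))
... | yes _ | no  _  = λ q → y'≢x (sym q)
... | no  _ | yes _  = y≢x
... | no  _ | no  _  = y≢y'

allPairs-weaken : ∀ {A : Set} {P : A → Set} {R R' : A → A → Set} {xs} → All P xs → AllPairs R xs
  → (∀ {a b} → P a → P b → R a b → R' a b) → AllPairs R' xs
allPairs-weaken []       []       f = []
allPairs-weaken (p ∷ ps) (h ∷ hs) f = All.zipWith (λ (q , r) → f p q r) (ps , h) ∷ allPairs-weaken ps hs f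

-- Induction on N: the head x is removed, and if x ≠ N the (at most one)
-- occurrence of N in the tail is renamed to x, so the tail lies below N.
distinct-below : ∀ N (ns : List ℕ) → AllPairs _≢_ ns → All (_< N) ns → length ns ≤ N
distinct-below N       []       _          _          = z≤n
distinct-below zero    (x ∷ ns) _          (() ∷ _)
distinct-below (suc N) (x ∷ ns) (x∉ ∷ dis) (x< ∷ ns<) with x ≟ N
... | yes refl = s≤s (distinct-below N ns dis
                       (All.zipWith (λ (x≢ , lt) → ≤∧≢⇒< (≤-pred lt) (λ e → x≢ (sym e))) (x∉ , ns<)))
... | no  x≢N  = s≤s (subst (_≤ N) (length-map (replace N x) ns)
                       (distinct-below N (map (replace N x) ns) renamed-distinct renamed-below))
  where
  renamed-distinct : AllPairs _≢_ (map (replace N x) ns)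
  renamed-distinct = AllPairsₚ.map⁺ (allPairs-weaken x∉ dis
    (λ {a} {b} x≢a x≢b a≢b → replace-injective N x a b (λ e → x≢a (sym e)) (λ e → x≢b (sym e)) a≢b))
  renamed-below : All (_< N) (map (replace N x) ns)
  renamed-below = Allₚ.map⁺ (All.map (λ {y} → replace-< N x y (≤∧≢⇒< (≤-pred x<) x≢N)) ns<)

allPairs-∈ : ∀ {A : Set} {R : A → A → Set} {xs : List A} {x y} → AllPairs R xs → x ∈ xs → y ∈ xs → x ≢ y → R x y ⊎ R y x
allPairs-∈ (h ∷ hs) (here refl) (here refl) x≢y = ⊥-elim (x≢y refl)
allPairs-∈ (h ∷ hs) (here refl) (there m)   _   = inj₁ (All.lookup h m)
allPairs-∈ (h ∷ hs) (there m)   (here refl) _   = inj₂ (All.lookup h m)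
allPairs-∈ (h ∷ hs) (there m)   (there m')  x≢y = allPairs-∈ hs m m' x≢y

unique-reverse : ∀ {A : Set} (xs : List A) → Unique xs → Unique (reverse xs)
unique-reverse []       u       = []
unique-reverse (x ∷ xs) (h ∷ u) = subst Unique (sym (unfold-reverse x xs))
  (Uniqueₚ.++⁺ (unique-reverse xs u) (All.[] ∷ [])
    (λ { (m , here refl) → All.lookup h (Anyₚ.reverse⁻ m) refl }))

module _ {A : Set} (R : A → A → Set) where

  LastRelated : List A → A → Set
  LastRelated []          a = ⊤
  LastRelated (x ∷ [])    a = R x a
  LastRelated (x ∷ y ∷ r) a = LastRelated (y ∷ r) a

  linked-∷ʳ : ∀ xs a → Linked R xs → LastRelated xs a → Linked R (xs ∷ʳ a)
  linked-∷ʳ []           a _       _ = [-]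
  linked-∷ʳ (x ∷ [])     a _       r = r ∷ [-]
  linked-∷ʳ (x ∷ y ∷ xs) a (r ∷ l) q = r ∷ linked-∷ʳ (y ∷ xs) a l q

  lastRelated-∷ʳ : ∀ zs b a → R b a → LastRelated (zs ∷ʳ b) a
  lastRelated-∷ʳ []            b a r = r
  lastRelated-∷ʳ (z ∷ [])      b a r = r
  lastRelated-∷ʳ (z ∷ z' ∷ zs) b a r = lastRelated-∷ʳ (z' ∷ zs) b a r

  linked-reverse : (∀ {u v} → R u v → R v u) → ∀ xs → Linked R xs → Linked R (reverse xs)
  linked-reverse R-sym []           _       = []
  linked-reverse R-sym (x ∷ [])     _       = [-]
  linked-reverse R-sym (x ∷ y ∷ xs) (r ∷ l) = subst (Linked R) (sym (unfold-reverse x (y ∷ xs)))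
    (linked-∷ʳ (reverse (y ∷ xs)) x (linked-reverse R-sym (y ∷ xs) l)
      (subst (λ z → LastRelated z x) (sym (unfold-reverse y xs)) (lastRelated-∷ʳ (reverse xs) y x (R-sym r))))

  linked-drop : ∀ i xs → Linked R xs → Linked R (drop i xs)
  linked-drop zero    xs       l = l
  linked-drop (suc i) []       l = l
  linked-drop (suc i) (x ∷ xs) l = linked-drop i xs (Linked.tail l)

  linked-take : ∀ m xs → Linked R xs → Linked R (take m xs)
  linked-take zero          xs           l       = []
  linked-take (suc m)       []           l       = []
  linked-take (suc zero)    (x ∷ xs)     l       = [-]
  linked-take (suc (suc m)) (x ∷ [])     l       = [-]
  linked-take (suc (suc m)) (x ∷ y ∷ xs) (r ∷ l) = r ∷ linked-take (suc m) (y ∷ xs) l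

module SegmentFacts {n : ℕ} (T : PlaneTree n) where
  open PlaneTree T

  cycAdjacent-sym : ∀ {L : List (Fin n)} {x y} → CycAdjacent L x y → CycAdjacent L y x
  cycAdjacent-sym (inj₁ a) = inj₂ a
  cycAdjacent-sym (inj₂ a) = inj₁ a

  LastTurn : List (Fin n) → Fin n → Set
  LastTurn (x ∷ y ∷ [])    a = CycAdjacent (nbrs y) x a
  LastTurn (x ∷ y ∷ z ∷ r) a = LastTurn (y ∷ z ∷ r) a
  LastTurn _               _ = ⊤

  turns-∷ʳ : ∀ xs a → Turns T xs → LastTurn xs a → Turns T (xs ∷ʳ a)
  turns-∷ʳ []              a _       _ = tt
  turns-∷ʳ (x ∷ [])        a _       _ = tt
  turns-∷ʳ (x ∷ y ∷ [])    a _       c = c , tt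
  turns-∷ʳ (x ∷ y ∷ z ∷ r) a (c , t) q = c , turns-∷ʳ (y ∷ z ∷ r) a t q

  lastTurn-++ : ∀ zs b c a → CycAdjacent (nbrs c) b a → LastTurn (zs ++ b ∷ c ∷ []) a
  lastTurn-++ []                b c a r = r
  lastTurn-++ (z ∷ [])          b c a r = r
  lastTurn-++ (z ∷ z' ∷ [])     b c a r = r
  lastTurn-++ (z ∷ z' ∷ w ∷ zs) b c a r = lastTurn-++ (z' ∷ w ∷ zs) b c a r

  turns-tail : ∀ x xs → Turns T (x ∷ xs) → Turns T xs
  turns-tail x []          t       = tt
  turns-tail x (y ∷ [])    t       = tt
  turns-tail x (y ∷ z ∷ r) (_ , t) = t

  -- being a legal turn is symmetric in the two edges, so Turns survives reversal
  turns-reverse : ∀ xs → Turns T xs → Turns T (reverse xs)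
  turns-reverse []              _       = tt
  turns-reverse (x ∷ [])        _       = tt
  turns-reverse (x ∷ y ∷ [])    _       = tt
  turns-reverse (x ∷ y ∷ z ∷ r) (c , t) = subst (Turns T) (sym (unfold-reverse x (y ∷ z ∷ r)))
    (turns-∷ʳ (reverse (y ∷ z ∷ r)) x (turns-reverse (y ∷ z ∷ r) t)
      (subst (λ w → LastTurn w x) (sym (reverse-++ (y ∷ z ∷ []) r))
        (lastTurn-++ (reverse r) z y x (cycAdjacent-sym {nbrs y} c))))

  turns-drop : ∀ i xs → Turns T xs → Turns T (drop i xs)
  turns-drop zero    xs       t = t
  turns-drop (suc i) []       t = t
  turns-drop (suc i) (x ∷ xs) t = turns-drop i xs (turns-tail x xs t)

  turns-take : ∀ m xs → Turns T xs → Turns T (take m xs)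
  turns-take zero                xs              t       = tt
  turns-take (suc m)             []              t       = tt
  turns-take (suc zero)          (x ∷ xs)        t       = tt
  turns-take (suc (suc m))       (x ∷ [])        t       = tt
  turns-take (suc (suc zero))    (x ∷ y ∷ xs)    t       = tt
  turns-take (suc (suc (suc m))) (x ∷ y ∷ [])    t       = tt
  turns-take (suc (suc (suc m))) (x ∷ y ∷ z ∷ r) (c , t) = c , turns-take (suc (suc m)) (y ∷ z ∷ r) t

  isSeg-reverse : ∀ xs → IsSeg T xs → IsSeg T (reverse xs)
  isSeg-reverse xs (len , uniq , linked , turns) =
    subst (2 ≤_) (sym (length-reverse xs)) len , unique-reverse xs uniq ,
    linked-reverse Adj (λ {u} {v} → symmetric u v) xs linked , turns-reverse xs turns

  isSeg-sublist : ∀ i m xs → IsSeg T xs → 2 ≤ length (take m (drop i xs)) → IsSeg T (take m (drop i xs))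
  isSeg-sublist i m xs (_ , uniq , linked , turns) len = len , Uniqueₚ.take⁺ m (Uniqueₚ.drop⁺ i uniq) ,
    linked-take Adj m (drop i xs) (linked-drop Adj i xs linked) , turns-take m (drop i xs) (turns-drop i xs turns)

  -- composability is symmetric (read both segments backwards) ...
  composable-sym : ∀ {x y} → Composable T x y → Composable T y x
  composable-sym {x} {y} (a₀ , v , b₀ , x≈ , y≈ , seg₁ , seg₂ , meet , seg₁₂) =
    reverse b₀ , v , reverse a₀ ,
    subst (SameSeg y) e₂ (sameSeg-trans y≈ (sameSeg-reverse (v ∷ b₀))) ,
    subst (SameSeg x) e₁ (sameSeg-trans x≈ (sameSeg-reverse (a₀ ∷ʳ v))) ,
    subst (IsSeg T) e₂ (isSeg-reverse _ seg₂) ,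
    subst (IsSeg T) e₁ (isSeg-reverse _ seg₁) ,
    (λ w m₁ m₂ → meet w (∈-reverse-≡ e₁ m₂) (∈-reverse-≡ e₂ m₁)) ,
    subst (IsSeg T) (reverse-around a₀ v b₀) (isSeg-reverse _ seg₁₂)
    where
    e₁ = reverse-∷ʳ a₀ v
    e₂ = unfold-reverse v b₀

  composable-resp : ∀ {x y x' y'} → SameSeg x x' → SameSeg y y' → Composable T x' y' → Composable T x y
  composable-resp x≈ y≈ (a₀ , v , b₀ , x'≈ , y'≈ , c) = a₀ , v , b₀ , sameSeg-trans x≈ x'≈ , sameSeg-trans y≈ y'≈ , c

-- Intervals of a fixed segment s = (s₀ , … , s_ℓ)

module Intervals {n : ℕ} (T : PlaneTree n) (v₀ : Fin n) (rest : List (Fin n))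
                 (s-seg : IsSeg T (v₀ ∷ rest)) where
  open PlaneTree T
  open SegmentFacts T
  open ≡-Reasoning

  s : List (Fin n)
  s = v₀ ∷ rest

  ℓ : ℕ
  ℓ = length rest

  L : ℕ
  L = length s

  pos : ℕ → Fin n
  pos = nth v₀ s

  -- sub i j = (s_i , … , s_{i+j}) , the interval [i , i+j]
  sub : ℕ → ℕ → List (Fin n)
  sub i j = map pos (range i (suc j))

  pos-injective : ∀ {p q} → p < L → q < L → pos p ≡ pos q → p ≡ q
  pos-injective {p} {q} = nth-injective v₀ s p q (proj₁ (proj₂ s-seg))

  s≡sub : s ≡ sub 0 ℓ
  s≡sub = nth-range-id v₀ s

  length-sub : ∀ i j → length (sub i j) ≡ suc j
  length-sub i j = trans (length-map pos (range i (suc j))) (length-range i (suc j))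

  ∈-sub⁻ : ∀ {w} i j → w ∈ sub i j → Σ ℕ λ p → i ≤ p × p ≤ i + j × w ≡ pos p
  ∈-sub⁻ i j m with ∈-map⁻ pos m
  ... | p , p∈ , e with ∈-range⁻ i (suc j) p p∈
  ... | i≤p , p< = p , i≤p , ≤-pred (subst (p <_) (+-suc i j) p<) , e

  ∈-sub⁺ : ∀ {p} i j → i ≤ p → p ≤ i + j → pos p ∈ sub i j
  ∈-sub⁺ {p} i j i≤p p≤ = ∈-map⁺ pos (∈-range⁺ i (suc j) p i≤p (subst (p <_) (sym (+-suc i j)) (s≤s p≤)))

  sub-++ : ∀ a q k → sub a (q + k) ≡ map pos (range a q) ++ sub (a + q) k
  sub-++ a q k = begin
    map pos (range a (suc (q + k)))            ≡⟨ cong (λ m → map pos (range a m)) (sym (+-suc q k)) ⟩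
    map pos (range a (q + suc k))              ≡⟨ cong (map pos) (range-+ a q (suc k)) ⟩
    map pos (range a q ++ range (a + q) (suc k)) ≡⟨ map-++ pos (range a q) _ ⟩
    map pos (range a q) ++ sub (a + q) k       ∎

  sub-∷ʳ : ∀ i j → sub i j ≡ map pos (range i j) ∷ʳ pos (i + j)
  sub-∷ʳ i j = trans (cong (sub i) (sym (+-identityʳ j))) (sub-++ i j 0)

  reverse-sub : ∀ i j → reverse (sub i j) ≡ pos (i + j) ∷ reverse (map pos (range i j))
  reverse-sub i j = trans (cong reverse (sub-∷ʳ i j)) (reverse-∷ʳ (map pos (range i j)) (pos (i + j)))

  take-sub : ∀ a k r → take (suc k) (sub a (k + r)) ≡ sub a k
  take-sub a k r = take-map-range pos a (suc k) r

  drop-sub : ∀ a q k → drop q (sub a (q + k)) ≡ sub (a + q) k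
  drop-sub a q k = trans (cong (λ m → drop q (map pos (range a m))) (sym (+-suc q k))) (drop-map-range pos a q (suc k))

  take-reverse-sub : ∀ a q k → take (suc k) (reverse (sub a (q + k))) ≡ reverse (sub (a + q) k)
  take-reverse-sub a q k = begin
    take (suc k) (reverse (sub a (q + k)))               ≡⟨ cong (λ z → take (suc k) (reverse z)) (sub-++ a q k) ⟩
    take (suc k) (reverse (map pos (range a q) ++ X))    ≡⟨ cong (take (suc k)) (reverse-++ (map pos (range a q)) X) ⟩
    take (suc k) (reverse X ++ Y)                        ≡⟨ cong (λ m → take m (reverse X ++ Y)) (sym |X|) ⟩
    take (length (reverse X)) (reverse X ++ Y)           ≡⟨ take-length-++ (reverse X) Y ⟩
    reverse X                                            ∎
    where
    X = sub (a + q) k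
    Y = reverse (map pos (range a q))
    |X| : length (reverse X) ≡ suc k
    |X| = trans (length-reverse X) (length-sub (a + q) k)

  isSeg-sub : ∀ i j → 1 ≤ j → i + j < L → IsSeg T (sub i j)
  isSeg-sub i j j≥1 lt with m≤n⇒∃[o]m+o≡n (subst (_≤ L) (sym (+-suc i j)) lt)
  ... | r , e = subst (IsSeg T) (sym sub≡) (isSeg-sublist i (suc j) s s-seg
                  (subst (2 ≤_) (trans (sym (length-sub i j)) (cong length sub≡)) (s≤s j≥1)))
    where
    sub≡ : sub i j ≡ take (suc j) (drop i s)
    sub≡ = sym (begin
      take (suc j) (drop i s)                                     ≡⟨ cong (λ z → take (suc j) (drop i z)) s≡sub ⟩
      take (suc j) (drop i (map pos (range 0 L)))                 ≡⟨ cong (λ m → take (suc j) (drop i (map pos (range 0 m)))) (sym e′) ⟩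
      take (suc j) (drop i (map pos (range 0 (i + (suc j + r))))) ≡⟨ cong (take (suc j)) (drop-map-range pos 0 i (suc j + r)) ⟩
      take (suc j) (map pos (range i (suc j + r)))                ≡⟨ take-map-range pos i (suc j) r ⟩
      sub i j                                                     ∎)
      where
      e′ : i + (suc j + r) ≡ L
      e′ = trans (sym (+-assoc i (suc j) r)) e

  i<L : ∀ i j → i + j < L → i < L
  i<L i j lt = ≤-trans (s≤s (m≤m+n i j)) lt

  1+i≤i+j : ∀ i j → 1 ≤ j → suc i ≤ i + j
  1+i≤i+j i j j≥1 = subst (_≤ i + j) (+-comm i 1) (+-monoʳ-≤ i j≥1)

  sameSeg-sub-injective : ∀ i j i' j' → i + j < L → i' + j' < L → SameSeg (sub i j) (sub i' j') → i ≡ i' × j ≡ j'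
  sameSeg-sub-injective i j i' j' lt lt' (inj₁ e) =
    pos-injective (i<L i j lt) (i<L i' j' lt') (∷-injectiveˡ e) ,
    suc-injective (trans (sym (length-sub i j)) (trans (cong length e) (length-sub i' j')))
  sameSeg-sub-injective i j i' j' lt lt' (inj₂ e) = endpoints-agree
    where
    -- a reversed interval has its endpoints swapped, forcing j = j' = 0
    i≡i'+j' : i ≡ i' + j'
    i≡i'+j' = pos-injective (i<L i j lt) lt' (∷-injectiveˡ (trans e (reverse-sub i' j')))
    i+j≡i' : i + j ≡ i'
    i+j≡i' = pos-injective lt (i<L i' j' lt')
      (∷-injectiveˡ (trans (sym (reverse-sub i j)) (trans (cong reverse e) (reverse-involutive (sub i' j')))))
    j'+j≡0 : j' + j ≡ 0
    j'+j≡0 = +-cancelˡ-≡ i' _ _ (begin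
      i' + (j' + j) ≡⟨ sym (+-assoc i' j' j) ⟩
      i' + j' + j   ≡⟨ cong (_+ j) (sym i≡i'+j') ⟩
      i + j         ≡⟨ i+j≡i' ⟩
      i'            ≡⟨ sym (+-identityʳ i') ⟩
      i' + 0        ∎)
    endpoints-agree : i ≡ i' × j ≡ j'
    endpoints-agree = trans i≡i'+j' (trans (cong (i' +_) (m+n≡0⇒m≡0 j' j'+j≡0)) (+-identityʳ i')) ,
                      trans (m+n≡0⇒n≡0 j' j'+j≡0) (sym (m+n≡0⇒m≡0 j' j'+j≡0))

  sameSeg-sub-unique : ∀ {x} i j i' j' → i + j < L → i' + j' < L → SameSeg x (sub i j) → SameSeg x (sub i' j') → i ≡ i' × j ≡ j'
  sameSeg-sub-unique i j i' j' lt lt' a b = sameSeg-sub-injective i j i' j' lt lt' (sameSeg-trans (sameSeg-sym a) b)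

  ProperPrefix : List (Fin n) → ℕ → ℕ → Set
  ProperPrefix x a j = Σ ℕ λ k → 1 ≤ k × k < j × SameSeg x (sub a k)

  ProperSuffix : List (Fin n) → ℕ → ℕ → Set
  ProperSuffix x a j = Σ ℕ λ q → Σ ℕ λ k → 1 ≤ q × 1 ≤ k × q + k ≡ j × SameSeg x (sub (a + q) k)

  prefix-or-suffix : ∀ {x} a k r → 1 ≤ k → 1 ≤ r
    → (SameSeg x (take (suc k) (sub a (k + r))) → ProperPrefix x a (k + r))
    × (SameSeg x (take (suc k) (reverse (sub a (k + r)))) → ProperSuffix x a (k + r))
  prefix-or-suffix {x} a k r k≥1 r≥1 =
    (λ h → k , k≥1 , subst (k <_) (+-comm r k) (m<n+m k r≥1) , subst (SameSeg x) (take-sub a k r) h) ,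
    (λ h → r , k , r≥1 , k≥1 , +-comm r k ,
       sameSeg-reverseʳ (subst (SameSeg x) (take-reverse-sub a r k)
         (subst (λ m → SameSeg x (take (suc k) (reverse (sub a m)))) (+-comm k r) h)))

  split-sub : ∀ {t x} a j → SameSeg t (sub a j) → Split t x → ProperPrefix x a j ⊎ ProperSuffix x a j
  split-sub a j t≈ (suc (suc k′) , s≤s (s≤s _) , k<|t| , x≈)
    with m≤n⇒∃[o]m+o≡n (≤-pred (subst (suc (suc k′) <_) (trans (sameSeg-length t≈) (length-sub a j)) k<|t|))
  ... | r′ , e = cases t≈ x≈
    where
    k = suc k′
    r = suc r′
    k+r≡j : k + r ≡ j
    k+r≡j = trans (+-suc k r′) e
    forwards : ∀ {x} → SameSeg x (take (suc k) (sub a j)) → ProperPrefix x a j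
    forwards {x} h = subst (ProperPrefix x a) k+r≡j
      (proj₁ (prefix-or-suffix a k r (s≤s z≤n) (s≤s z≤n))
        (subst (λ m → SameSeg x (take (suc k) (sub a m))) (sym k+r≡j) h))
    backwards : ∀ {x} → SameSeg x (take (suc k) (reverse (sub a j))) → ProperSuffix x a j
    backwards {x} h = subst (ProperSuffix x a) k+r≡j
      (proj₂ (prefix-or-suffix a k r (s≤s z≤n) (s≤s z≤n))
        (subst (λ m → SameSeg x (take (suc k) (reverse (sub a m)))) (sym k+r≡j) h))
    cases : ∀ {t x} → SameSeg t (sub a j) → (SameSeg x (take (suc k) t) ⊎ SameSeg x (take (suc k) (reverse t)))
          → ProperPrefix x a j ⊎ ProperSuffix x a j
    cases (inj₁ refl) (inj₁ h) = inj₁ (forwards h)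
    cases (inj₁ refl) (inj₂ h) = inj₂ (backwards h)
    cases (inj₂ refl) (inj₁ h) = inj₂ (backwards h)
    cases (inj₂ refl) (inj₂ h) = inj₁ (forwards (subst (λ z → SameSeg _ (take (suc k) z)) (reverse-involutive (sub a j)) h))

  suffix-split : ∀ {t x} a q k → 1 ≤ q → 1 ≤ k → SameSeg t (sub a (q + k)) → SameSeg x (sub (a + q) k) → Split t x
  suffix-split {t} {x} a q k q≥1 k≥1 t≈ x≈ = suc k , s≤s k≥1 , lt , orient t≈
    where
    lt : suc k < length t
    lt = subst (suc k <_) (sym (trans (sameSeg-length t≈) (length-sub a (q + k)))) (s≤s (m<n+m k q≥1))
    h : SameSeg x (take (suc k) (reverse (sub a (q + k))))
    h = subst (SameSeg x) (sym (take-reverse-sub a q k)) (sameSeg-trans x≈ (sameSeg-reverse (sub (a + q) k)))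
    orient : SameSeg t (sub a (q + k)) → SameSeg x (take (suc k) t) ⊎ SameSeg x (take (suc k) (reverse t))
    orient (inj₁ refl) = inj₂ h
    orient (inj₂ refl) = inj₁ h

  prefix-split : ∀ {t x} a k r → 1 ≤ k → 1 ≤ r → SameSeg t (sub a (k + r)) → SameSeg x (sub a k) → Split t x
  prefix-split {t} {x} a k r k≥1 r≥1 t≈ x≈ = suc k , s≤s k≥1 , lt , orient t≈
    where
    lt : suc k < length t
    lt = subst (suc k <_) (sym (trans (sameSeg-length t≈) (length-sub a (k + r))))
               (s≤s (subst (k <_) (+-comm r k) (m<n+m k r≥1)))
    h : SameSeg x (take (suc k) (sub a (k + r)))
    h = subst (SameSeg x) (sym (take-sub a k r)) x≈
    orient : SameSeg t (sub a (k + r)) → SameSeg x (take (suc k) t) ⊎ SameSeg x (take (suc k) (reverse t))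
    orient (inj₁ refl) = inj₁ h
    orient (inj₂ refl) = inj₂ (subst (λ z → SameSeg x (take (suc k) z)) (sym (reverse-involutive (sub a (k + r)))) h)

  adjacent-composable : ∀ i j j' → 1 ≤ j → 1 ≤ j' → (i + j) + j' < L → Composable T (sub i j) (sub (i + j) j')
  adjacent-composable i j j' j≥1 j'≥1 lt =
    map pos (range i j) , pos (i + j) , map pos (range (suc (i + j)) j') ,
    inj₁ (sub-∷ʳ i j) , inj₁ refl ,
    subst (IsSeg T) (sub-∷ʳ i j) (isSeg-sub i j j≥1 i+j<L) ,
    isSeg-sub (i + j) j' j'≥1 lt ,
    meet-only-at-join ,
    subst (IsSeg T) (sub-++ i j j') (isSeg-sub i (j + j') (≤-trans j≥1 (m≤m+n j j')) (subst (_< L) (+-assoc i j j') lt))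
    where
    i+j<L : i + j < L
    i+j<L = ≤-trans (s≤s (m≤m+n (i + j) j')) lt
    meet-only-at-join : ∀ w → w ∈ map pos (range i j) ∷ʳ pos (i + j) → w ∈ sub (i + j) j' → w ≡ pos (i + j)
    meet-only-at-join w m₁ m₂ with ∈-sub⁻ i j (subst (w ∈_) (sym (sub-∷ʳ i j)) m₁) | ∈-sub⁻ (i + j) j' m₂
    ... | p , _ , p≤ , refl | p' , p'≥ , p'≤ , e' = cong pos (≤-antisym p≤ (subst (i + j ≤_) (sym p≡p') p'≥))
      where
      p≡p' : p ≡ p'
      p≡p' = pos-injective (≤-<-trans p≤ i+j<L) (≤-<-trans p'≤ lt) e'

  joint-at-endˡ : ∀ {a₀ v} i j → SameSeg (a₀ ∷ʳ v) (sub i j) → v ≡ pos i ⊎ v ≡ pos (i + j)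
  joint-at-endˡ {a₀} i j (inj₁ e) = inj₂ (∷ʳ-injectiveʳ a₀ _ (trans e (sub-∷ʳ i j)))
  joint-at-endˡ {a₀} {v} i j (inj₂ e) =
    inj₁ (∷-injectiveˡ (trans (sym (reverse-∷ʳ a₀ v)) (trans (cong reverse e) (reverse-involutive (sub i j)))))

  joint-at-endʳ : ∀ {b₀ v} i j → SameSeg (v ∷ b₀) (sub i j) → v ≡ pos i ⊎ v ≡ pos (i + j)
  joint-at-endʳ i j (inj₁ e) = inj₁ (∷-injectiveˡ e)
  joint-at-endʳ i j (inj₂ e) = inj₂ (∷-injectiveˡ (trans e (reverse-sub i j)))

  common-position : ∀ {a₀ v b₀} i j i' j' p → (∀ w → w ∈ a₀ ∷ʳ v → w ∈ v ∷ b₀ → w ≡ v)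
    → SameSeg (a₀ ∷ʳ v) (sub i j) → SameSeg (v ∷ b₀) (sub i' j')
    → i ≤ p → p ≤ i + j → i' ≤ p → p ≤ i' + j' → pos p ≡ v
  common-position i j i' j' p meet x≈ y≈ a b a' b' =
    meet (pos p) (sameSeg-∈ x≈ (∈-sub⁺ i j a b)) (sameSeg-∈ y≈ (∈-sub⁺ i' j' a' b'))

  -- Composable intervals with at least one edge each meet end to start:
  -- the joint is the end of one and the start of the other.  (Sharing the
  -- start, they would share the next vertex too; likewise at the end.)
  composable-sub : ∀ {x y} i j i' j' → 1 ≤ j → 1 ≤ j' → i + j < L → i' + j' < L
    → SameSeg x (sub i j) → SameSeg y (sub i' j') → Composable T x y → i + j ≡ i' ⊎ i' + j' ≡ i
  composable-sub {x} {y} i j i' j' j≥1 j'≥1 lt lt' x≈ y≈ (a₀ , v , b₀ , x≈′ , y≈′ , _ , _ , meet , _) =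
    cases (joint-at-endˡ i j ex) (joint-at-endʳ i' j' ey)
    where
    ex = sameSeg-trans (sameSeg-sym x≈′) x≈
    ey = sameSeg-trans (sameSeg-sym y≈′) y≈
    same-start : v ≡ pos i → v ≡ pos i' → ⊥
    same-start e e' = <-irrefl (pos-injective (i<L i j lt) (≤-<-trans (1+i≤i+j i j j≥1) lt) (trans (sym e) (sym next≡v)))
                               (n<1+n i)
      where
      i≡i' : i ≡ i'
      i≡i' = pos-injective (i<L i j lt) (i<L i' j' lt') (trans (sym e) e')
      next≡v : pos (suc i) ≡ v
      next≡v = common-position i j i' j' (suc i) meet ex ey (n≤1+n i) (1+i≤i+j i j j≥1)
                 (subst (_≤ suc i) i≡i' (n≤1+n i)) (subst (λ z → suc i ≤ z + j') i≡i' (1+i≤i+j i j' j'≥1))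
    same-end : v ≡ pos (i + j) → v ≡ pos (i' + j') → ⊥
    same-end e e' = <-irrefl (pos-injective (<-trans before<end lt) lt (trans before≡v e)) before<end
      where
      j₀ = j ∸ 1
      i+j≡ : i + j ≡ suc (i + j₀)
      i+j≡ = trans (cong (i +_) (sym (m+[n∸m]≡n j≥1))) (+-suc i j₀)
      before<end : i + j₀ < i + j
      before<end = ≤-reflexive (sym i+j≡)
      end≡ : i + j ≡ i' + j'
      end≡ = pos-injective lt lt' (trans (sym e) e')
      before≡v : pos (i + j₀) ≡ v
      before≡v = common-position i j i' j' (i + j₀) meet ex ey (m≤m+n i j₀) (<⇒≤ before<end)
                   (≤-pred (≤-trans (1+i≤i+j i' j' j'≥1) (≤-reflexive (trans (sym end≡) i+j≡))))
                   (≤-trans (<⇒≤ before<end) (≤-reflexive end≡))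
    cases : v ≡ pos i ⊎ v ≡ pos (i + j) → v ≡ pos i' ⊎ v ≡ pos (i' + j') → i + j ≡ i' ⊎ i' + j' ≡ i
    cases (inj₂ e) (inj₁ e') = inj₁ (pos-injective lt (i<L i' j' lt') (trans (sym e) e'))
    cases (inj₁ e) (inj₂ e') = inj₂ (pos-injective lt' (i<L i j lt) (trans (sym e') e))
    cases (inj₁ e) (inj₁ e') = ⊥-elim (same-start e e')
    cases (inj₂ e) (inj₂ e') = ⊥-elim (same-end e e')

  split-sub-≡ : ∀ {a₀ v b₀} i j → a₀ ++ v ∷ b₀ ≡ sub i j
    → length a₀ + length b₀ ≡ j × a₀ ∷ʳ v ≡ sub i (length a₀) × v ∷ b₀ ≡ sub (i + length a₀) (length b₀)
  split-sub-≡ {a₀} {v} {b₀} i j e = q+r≡j , trans (cong₂ _∷ʳ_ (proj₁ parts) v≡) (sym (sub-∷ʳ i q)) , proj₂ parts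
    where
    q = length a₀
    r = length b₀
    q+r≡j : q + r ≡ j
    q+r≡j = suc-injective (trans (sym (+-suc q r))
              (trans (sym (length-++ a₀ {v ∷ b₀})) (trans (cong length e) (length-sub i j))))
    parts = ++-injective a₀ (map pos (range i q)) (v ∷ b₀) (sub (i + q) r)
              (trans e (trans (cong (sub i) (sym q+r≡j)) (sub-++ i q r)))
              (sym (trans (length-map pos (range i q)) (length-range i q)))
    v≡ : v ≡ pos (i + q)
    v≡ = ∷-injectiveˡ (proj₂ parts)

  Pieces : List (Fin n) → List (Fin n) → ℕ → ℕ → Set
  Pieces x y i j = Σ ℕ λ q → Σ ℕ λ r → 1 ≤ q × 1 ≤ r × q + r ≡ j ×
    ((SameSeg x (sub i q) × SameSeg y (sub (i + q) r)) ⊎ (SameSeg x (sub (i + q) r) × SameSeg y (sub i q)))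

  pieces : ∀ {a₀ v b₀} i j → 1 ≤ length a₀ → 1 ≤ length b₀ → SameSeg (a₀ ++ v ∷ b₀) (sub i j)
    → Pieces (a₀ ∷ʳ v) (v ∷ b₀) i j
  pieces {a₀} {v} {b₀} i j a≥1 b≥1 (inj₁ e) with split-sub-≡ {a₀} {v} {b₀} i j e
  ... | q+r≡j , e₁ , e₂ = length a₀ , length b₀ , a≥1 , b≥1 , q+r≡j , inj₁ (inj₁ e₁ , inj₁ e₂)
  pieces {a₀} {v} {b₀} i j a≥1 b≥1 (inj₂ e) with split-sub-≡ {reverse b₀} {v} {reverse a₀} i j reversed
    where
    reversed : reverse b₀ ++ v ∷ reverse a₀ ≡ sub i j
    reversed = trans (sym (reverse-around a₀ v b₀)) (trans (cong reverse e) (reverse-involutive (sub i j)))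
  ... | q+r≡j , e₁ , e₂ = length (reverse b₀) , length (reverse a₀) ,
        subst (1 ≤_) (sym (length-reverse b₀)) b≥1 , subst (1 ≤_) (sym (length-reverse a₀)) a≥1 , q+r≡j ,
        inj₂ (sameSeg-trans (sameSeg-reverse (a₀ ∷ʳ v)) (inj₁ (trans (reverse-∷ʳ a₀ v) e₂)) ,
              sameSeg-trans (sameSeg-reverse (v ∷ b₀)) (inj₁ (trans (unfold-reverse v b₀) e₁)))

  s≈sub : SameSeg s (sub 0 ℓ)
  s≈sub = inj₁ s≡sub

  Interior : ℕ → Set
  Interior p = 1 ≤ p × p < ℓ

  Head : List (Fin n) → ℕ → Set
  Head x k = SameSeg x (sub 0 k)

  Tail : List (Fin n) → ℕ → Set
  Tail x b = Σ ℕ λ j → b + j ≡ ℓ × SameSeg x (sub b j)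

  split-of-s : ∀ {x} → Split s x → Σ ℕ λ p → Interior p × (Head x p ⊎ Tail x p)
  split-of-s sp with split-sub 0 ℓ s≈sub sp
  ... | inj₁ (k , k≥1 , k<ℓ , x≈)               = k , (k≥1 , k<ℓ) , inj₁ x≈
  ... | inj₂ (q , k , q≥1 , k≥1 , q+k≡ℓ , x≈)   = q , (q≥1 , subst (q <_) q+k≡ℓ (m<m+n q k≥1)) , inj₂ (k , q+k≡ℓ , x≈)

  tail-nonempty : ∀ b j → b < ℓ → b + j ≡ ℓ → 1 ≤ j
  tail-nonempty b zero    b<ℓ e = ⊥-elim (<-irrefl (trans (sym (+-identityʳ b)) e) b<ℓ)
  tail-nonempty b (suc j) b<ℓ e = s≤s z≤n

  s≡sub-+ : ∀ p j → p + j ≡ ℓ → s ≡ sub 0 (p + j)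
  s≡sub-+ p j e = trans s≡sub (cong (sub 0) (sym e))

  head-split : ∀ {x} k → Interior k → Head x k → Split s x
  head-split k (k≥1 , k<ℓ) x≈ with m≤n⇒∃[o]m+o≡n k<ℓ
  ... | r , e = prefix-split 0 k (suc r) k≥1 (s≤s z≤n) (inj₁ (s≡sub-+ k (suc r) (trans (+-suc k r) e))) x≈

  tail-split : ∀ {x} b j → 1 ≤ b → 1 ≤ j → b + j ≡ ℓ → SameSeg x (sub b j) → Split s x
  tail-split b j b≥1 j≥1 e x≈ = suffix-split 0 b j b≥1 j≥1 (inj₁ (s≡sub-+ b j e)) x≈

  head-tail-break : ∀ {x y} p → Interior p → Head x p → Tail y p → SameBreak s x y
  head-tail-break {x} {y} p (p≥1 , p<ℓ) x≈ (j , e , y≈) =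
    p , p≥1 , subst (_≤ L) (+-comm 2 p) (s≤s p<ℓ) ,
    inj₁ (subst (SameSeg x) (sym take≡) x≈ , subst (SameSeg y) (sym drop≡) y≈)
    where
    take≡ : take (suc p) s ≡ sub 0 p
    take≡ = trans (cong (take (suc p)) (s≡sub-+ p j e)) (take-sub 0 p j)
    drop≡ : drop p s ≡ sub p j
    drop≡ = trans (cong (drop p) (s≡sub-+ p j e)) (drop-sub 0 p j)

  sameBreak-sym : ∀ {x y} → SameBreak s x y → SameBreak s y x
  sameBreak-sym (i , i≥1 , i+2≤ , inj₁ (u , v)) = i , i≥1 , i+2≤ , inj₂ (u , v)
  sameBreak-sym (i , i≥1 , i+2≤ , inj₂ (u , v)) = i , i≥1 , i+2≤ , inj₁ (u , v)

  same-position : ∀ {x y} p → Interior p → Head x p ⊎ Tail x p → Head y p ⊎ Tail y p → SameSeg x y ⊎ SameBreak s x y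
  same-position p int (inj₁ x≈) (inj₁ y≈) = inj₁ (sameSeg-trans x≈ (sameSeg-sym y≈))
  same-position p int (inj₁ hx) (inj₂ ty) = inj₂ (head-tail-break p int hx ty)
  same-position p int (inj₂ tx) (inj₁ hy) = inj₂ (sameBreak-sym (head-tail-break p int hy tx))
  same-position p int (inj₂ (j , e , x≈)) (inj₂ (j' , e' , y≈)) =
    inj₁ (sameSeg-trans x≈ (sameSeg-sym (subst (λ z → SameSeg _ (sub p z)) (+-cancelˡ-≡ p _ _ (trans e' (sym e))) y≈)))

  -- The marking of interior positions induced by a label (s , D)

  module Marking (D : List (List (Fin n))) (label : IsLabel T s D) where

    Apart : List (Fin n) → List (Fin n) → Set
    Apart x y = ¬ SameSeg x y × ¬ SameBreak s x y

    D-splits : All (Split s) D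
    D-splits = proj₁ (proj₂ label)

    D-size : length D ≡ numBreaks s
    D-size = proj₁ (proj₂ (proj₂ label))

    D-apart : AllPairs Apart D
    D-apart = proj₂ (proj₂ (proj₂ label))

    HeadMark : ℕ → Set
    HeadMark p = Any (λ x → Head x p) D

    TailMark : ℕ → Set
    TailMark p = Any (λ x → Tail x p) D

    -- the two splits at an interior p form a break, so D cannot contain both
    not-both-marks : ∀ p → Interior p → HeadMark p → TailMark p → ⊥
    not-both-marks p int@(p≥1 , p<ℓ) hm tm with find hm | find tm
    ... | x , x∈D , hx | y , y∈D , ty@(j , e , y≈) with allPairs-∈ D-apart x∈D y∈D x≢y
      where
      x≢y : x ≢ y
      x≢y refl = <-irrefl (proj₁ (sameSeg-sub-unique 0 p p j (m<n⇒m<1+n p<ℓ) (subst (_< L) (sym e) (n<1+n ℓ)) hx y≈)) p≥1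
    ... | inj₁ (_ , not-break) = not-break (head-tail-break p int hx ty)
    ... | inj₂ (_ , not-break) = not-break (sameBreak-sym (head-tail-break p int hx ty))

    position : ∀ {x} → Split s x → ℕ
    position sp = proj₁ (split-of-s sp)

    length-positions : ∀ {xs} (sps : All (Split s) xs) → length (All.reduce position sps) ≡ length xs
    length-positions []         = refl
    length-positions (sp ∷ sps) = cong suc (length-positions sps)

    positions-interior : ∀ {xs} (sps : All (Split s) xs) → All Interior (All.reduce position sps)
    positions-interior []         = []
    positions-interior (sp ∷ sps) = proj₁ (proj₂ (split-of-s sp)) ∷ positions-interior sps

    ∈-positions : ∀ {xs} (sps : All (Split s) xs) p → p ∈ All.reduce position sps → Any (λ x → Head x p ⊎ Tail x p) xs
    ∈-positions (sp ∷ sps) p (here refl) = here (proj₂ (proj₂ (split-of-s sp)))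
    ∈-positions (sp ∷ sps) p (there p∈) = there (∈-positions sps p p∈)

    positions-distinct : ∀ {xs} (sps : All (Split s) xs) → AllPairs Apart xs → AllPairs _≢_ (All.reduce position sps)
    positions-distinct []         []         = []
    positions-distinct (sp ∷ sps) (ap ∷ aps) = head-distinct sps ap ∷ positions-distinct sps aps
      where
      head-distinct : ∀ {ys} (tps : All (Split s) ys) → All (Apart _) ys → All (position sp ≢_) (All.reduce position tps)
      head-distinct []         []                   = []
      head-distinct (tp ∷ tps) ((≉ , ¬break) ∷ aps′) = same-position⇒⊥ ∷ head-distinct tps aps′
        where
        same-position⇒⊥ : position sp ≢ position tp
        same-position⇒⊥ e = [ ≉ , ¬break ]′
          (same-position (position sp) (proj₁ (proj₂ (split-of-s sp)))
            (proj₂ (proj₂ (split-of-s sp)))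
            (subst (λ q → Head _ q ⊎ Tail _ q) (sym e) (proj₂ (proj₂ (split-of-s tp)))))

    -- Counting: D has ℓ - 1 splits at distinct positions among the ℓ - 1
    -- interior ones.  Were p missing, 0 , p and these positions would be
    -- ℓ + 1 distinct numbers below ℓ.
    some-mark : ∀ p → Interior p → HeadMark p ⊎ TailMark p
    some-mark p (p≥1 , p<ℓ) with p ∈? All.reduce position D-splits
    ... | yes p∈ = Anyₚ.Any-⊎⁻ (∈-positions D-splits p p∈)
    ... | no  p∉ = ⊥-elim (<-irrefl refl (≤-trans (≤-reflexive (sym too-many)) (distinct-below ℓ ns distinct below)))
      where
      ps = All.reduce position D-splits
      ns = 0 ∷ p ∷ ps
      distinct : AllPairs _≢_ ns
      distinct = ((λ e → <-irrefl e p≥1) ∷ All.map (λ (q≥1 , _) e → <-irrefl e q≥1) (positions-interior D-splits))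
               ∷ Allₚ.¬Any⇒All¬ ps p∉ ∷ positions-distinct D-splits D-apart
      below : All (_< ℓ) ns
      below = ≤-<-trans z≤n p<ℓ ∷ p<ℓ ∷ All.map proj₂ (positions-interior D-splits)
      too-many : length ns ≡ L
      too-many = trans (cong (λ z → 2 + z) (trans (length-positions D-splits) D-size)) (m+[n∸m]≡n (proj₁ s-seg))

    Opens : ℕ → Set
    Opens i = i ≡ 0 ⊎ TailMark i

    Closes : ℕ → Set
    Closes k = k ≡ ℓ ⊎ HeadMark k

    Marked : List (Fin n) → Set
    Marked x = Σ ℕ λ i → Σ ℕ λ j → 1 ≤ j × i + j < L × SameSeg x (sub i j) × Opens i × Closes (i + j)

    opens-closes-clash : ∀ p → Interior p → Closes p → Opens p → ⊥
    opens-closes-clash p (_ , p<ℓ)  (inj₁ p≡ℓ) _          = <-irrefl p≡ℓ p<ℓ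
    opens-closes-clash p (p≥1 , _)  _          (inj₁ p≡0) = <-irrefl (sym p≡0) p≥1
    opens-closes-clash p int        (inj₂ hm)  (inj₂ tm)  = not-both-marks p int hm tm

    interior-end : ∀ i j j' → 1 ≤ j → 1 ≤ j' → (i + j) + j' < L → Interior (i + j)
    interior-end i j j' j≥1 j'≥1 lt = ≤-trans j≥1 (m≤n+m j i) , ≤-trans (1+i≤i+j (i + j) j' j'≥1) (≤-pred lt)

    s-marked : ∀ {x} → SameSeg x s → Marked x
    s-marked x≈ = 0 , ℓ , ≤-pred (proj₁ s-seg) , n<1+n ℓ , sameSeg-trans x≈ s≈sub , inj₁ refl , inj₁ refl

    D-marked : ∀ {x t} → t ∈ D → SameSeg x t → Marked x
    D-marked t∈D x≈ with split-of-s (All.lookup D-splits t∈D)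
    ... | p , (p≥1 , p<ℓ) , inj₁ t≈ =
      0 , p , p≥1 , m<n⇒m<1+n p<ℓ , sameSeg-trans x≈ t≈ , inj₁ refl , inj₂ (lose t∈D t≈)
    ... | p , (p≥1 , p<ℓ) , inj₂ (j , e , t≈) =
      p , j , tail-nonempty p j p<ℓ e , subst (_< L) (sym e) (n<1+n ℓ) , sameSeg-trans x≈ t≈ , inj₂ (lose t∈D (j , e , t≈)) , inj₁ e

    -- the members of S(t) for a head t = [0 , a] in D are the intervals [q , a]
    -- with q opening: a head mark at q would give a split of D composable with x
    S-of-head-marked : ∀ {x t} a → Interior a → t ∈ D → Head t a → SJ T s D t x → Marked x
    S-of-head-marked {t = t} a (a≥1 , a<ℓ) t∈D t≈ (x-split , ¬s-split , ¬comp) with split-sub 0 a t≈ x-split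
    ... | inj₁ (k , k≥1 , k<a , x≈) = ⊥-elim (¬s-split (head-split k (k≥1 , <-trans k<a a<ℓ) x≈))
    ... | inj₂ (q , k , q≥1 , k≥1 , q+k≡a , x≈) =
      q , k , k≥1 , q+k<L , x≈ , opens , inj₂ (lose t∈D (subst (Head t) (sym q+k≡a) t≈))
      where
      q+k<L : q + k < L
      q+k<L = subst (_< L) (sym q+k≡a) (m<n⇒m<1+n a<ℓ)
      opens : Opens q
      opens with some-mark q (q≥1 , ≤-trans (1+i≤i+j q k k≥1) (subst (_≤ ℓ) (sym q+k≡a) (<⇒≤ a<ℓ)))
      ... | inj₂ tm = inj₂ tm
      ... | inj₁ hm with find hm
      ...   | d , d∈D , d≈ = ⊥-elim (All.lookup ¬comp d∈D
                (composable-resp x≈ d≈ (composable-sym (adjacent-composable 0 q k q≥1 k≥1 q+k<L))))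

    S-of-tail-marked : ∀ {x t} b → Interior b → t ∈ D → Tail t b → SJ T s D t x → Marked x
    S-of-tail-marked b (b≥1 , b<ℓ) t∈D t-tail@(j , b+j≡ℓ , t≈) (x-split , ¬s-split , ¬comp) with split-sub b j t≈ x-split
    ... | inj₂ (q , k , q≥1 , k≥1 , q+k≡j , x≈) =
      ⊥-elim (¬s-split (tail-split (b + q) k (≤-trans b≥1 (m≤m+n b q)) k≥1
                         (trans (+-assoc b q k) (trans (cong (b +_) q+k≡j) b+j≡ℓ)) x≈))
    ... | inj₁ (k , k≥1 , k<j , x≈) = b , k , k≥1 , <-trans b+k<ℓ (n<1+n ℓ) , x≈ , inj₂ (lose t∈D t-tail) , closes
      where
      b+k<ℓ : b + k < ℓ
      b+k<ℓ = subst (b + k <_) b+j≡ℓ (+-monoʳ-< b k<j)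
      closes : Closes (b + k)
      closes with some-mark (b + k) (≤-trans b≥1 (m≤m+n b k) , b+k<ℓ)
      ... | inj₁ hm = inj₂ hm
      ... | inj₂ tm with find tm
      ...   | d , d∈D , (j′ , e′ , d≈) = ⊥-elim (All.lookup ¬comp d∈D
                (composable-resp x≈ d≈ (adjacent-composable b k j′ k≥1 (tail-nonempty (b + k) j′ b+k<ℓ e′)
                                                              (subst (_< L) (sym e′) (n<1+n ℓ)))))

    J⇒marked : ∀ {x} → J T s D x → Marked x
    J⇒marked (inj₁ x≈s) = s-marked x≈s
    J⇒marked (inj₂ (inj₁ x∈D)) with find x∈D
    ... | t , t∈D , x≈t = D-marked t∈D x≈t
    J⇒marked (inj₂ (inj₂ x∈S)) with find x∈S
    ... | t , t∈D , x∈St with split-of-s (All.lookup D-splits t∈D)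
    ...   | p , int , inj₁ t-head = S-of-head-marked p int t∈D t-head x∈St
    ...   | p , int , inj₂ t-tail = S-of-tail-marked p int t∈D t-tail x∈St

    -- an interval opening and closing at interior positions lies in S(t) for
    -- the head t = [0 , i+j] marking its end
    inner-in-S : ∀ {x} i j → 1 ≤ j → Interior i → Interior (i + j) → SameSeg x (sub i j)
      → TailMark i → HeadMark (i + j) → J T s D x
    inner-in-S {x} i j j≥1 int-i@(i≥1 , i<ℓ) int-k@(k≥1 , i+j<ℓ) x≈ tm hm with find hm
    ... | t , t∈D , t≈ = inj₂ (inj₂ (lose t∈D (suffix-split 0 i j i≥1 j≥1 t≈ x≈ , ¬s-split , All.tabulate ¬comp)))
      where
      lt : i + j < L
      lt = m<n⇒m<1+n i+j<ℓ
      ¬s-split : ¬ Split s x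
      ¬s-split sp with split-of-s sp
      ... | p , (_ , p<ℓ) , inj₁ x≈′ = <-irrefl (sym (proj₁ (sameSeg-sub-unique i j 0 p lt (m<n⇒m<1+n p<ℓ) x≈ x≈′))) i≥1
      ... | p , _ , inj₂ (j′ , e , x≈′) with sameSeg-sub-unique i j p j′ lt (subst (_< L) (sym e) (n<1+n ℓ)) x≈ x≈′
      ...   | refl , refl = <-irrefl e i+j<ℓ
      ¬comp : ∀ {f} → f ∈ D → ¬ Composable T x f
      ¬comp {f} f∈D cmp with split-of-s (All.lookup D-splits f∈D)
      ... | p , (p≥1 , p<ℓ) , inj₁ f≈ with composable-sub i j 0 p j≥1 p≥1 lt (m<n⇒m<1+n p<ℓ) x≈ f≈ cmp
      ...   | inj₁ i+j≡0 = <-irrefl (sym i+j≡0) k≥1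
      ...   | inj₂ p≡i   = not-both-marks i int-i (lose f∈D (subst (Head f) p≡i f≈)) tm
      ¬comp {f} f∈D cmp | p , (_ , p<ℓ) , inj₂ f-tail@(j′ , e , f≈)
        with composable-sub i j p j′ j≥1 (tail-nonempty p j′ p<ℓ e) lt (subst (_< L) (sym e) (n<1+n ℓ)) x≈ f≈ cmp
      ...   | inj₁ i+j≡p = not-both-marks (i + j) int-k hm (lose f∈D (subst (Tail f) (sym i+j≡p) f-tail))
      ...   | inj₂ p+j′≡i = <-irrefl (trans (sym p+j′≡i) e) i<ℓ

    marked⇒J : ∀ {x} → Marked x → J T s D x
    marked⇒J (i , j , _ , _ , x≈ , inj₁ refl , inj₁ e) = inj₁ (sameSeg-trans x≈ (sameSeg-sym (inj₁ (s≡sub-+ 0 j e))))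
    marked⇒J (i , j , _ , _ , x≈ , inj₁ refl , inj₂ hm) with find hm
    ... | t , t∈D , t≈ = inj₂ (inj₁ (lose t∈D (sameSeg-trans x≈ (sameSeg-sym t≈))))
    marked⇒J (i , j , _ , _ , x≈ , inj₂ tm , inj₁ e) with find tm
    ... | t , t∈D , (j′ , e′ , t≈) = inj₂ (inj₁ (lose t∈D (sameSeg-trans x≈ (sameSeg-sym (subst (λ z → SameSeg t (sub i z)) j′≡j t≈)))))
      where
      j′≡j : j′ ≡ j
      j′≡j = +-cancelˡ-≡ i _ _ (trans e′ (sym e))
    marked⇒J (i , j , j≥1 , lt , x≈ , inj₂ tm , inj₂ hm) with i ≟ 0 | i + j ≟ ℓ
    ... | yes refl | _     = marked⇒J (i , j , j≥1 , lt , x≈ , inj₁ refl , inj₂ hm)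
    ... | no  _    | yes e = marked⇒J (i , j , j≥1 , lt , x≈ , inj₂ tm , inj₁ e)
    ... | no  i≢0  | no  k≢ℓ = inner-in-S i j j≥1 (i≥1 , <-≤-trans (1+i≤i+j i j j≥1) (<⇒≤ i+j<ℓ)) (≤-trans j≥1 (m≤n+m j i) , i+j<ℓ)
                                 x≈ tm hm
      where
      i≥1 : 1 ≤ i
      i≥1 = ≤∧≢⇒< z≤n (λ e → i≢0 (sym e))
      i+j<ℓ : i + j < ℓ
      i+j<ℓ = ≤∧≢⇒< (≤-pred lt) k≢ℓ

    -- marked intervals are never composable: they would meet at an interior
    -- position that both closes one and opens the other
    marked-not-composable : ∀ {x y} → Marked x → Marked y → ¬ Composable T x y
    marked-not-composable (i , j , j≥1 , lt , x≈ , opens , closes) (i′ , j′ , j′≥1 , lt′ , y≈ , opens′ , closes′) cmp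
      with composable-sub i j i′ j′ j≥1 j′≥1 lt lt′ x≈ y≈ cmp
    ... | inj₁ refl = opens-closes-clash (i + j) (interior-end i j j′ j≥1 j′≥1 lt′) closes opens′
    ... | inj₂ refl = opens-closes-clash (i′ + j′) (interior-end i′ j′ j j′≥1 j≥1 lt) closes′ opens

    Mem-marked : ∀ {x} → Mem T (J T s D) x → Marked x
    Mem-marked (inj₁ x∈J) = J⇒marked x∈J
    Mem-marked {x} (inj₂ x∈J) with J⇒marked x∈J
    ... | i , j , j≥1 , lt , x≈ , opens , closes = i , j , j≥1 , lt , sameSeg-trans (sameSeg-reverse x) x≈ , opens , closes

    J-not-composable : ∀ x y → J T s D x → J T s D y → ¬ Composable T x y
    J-not-composable x y x∈J y∈J = marked-not-composable (J⇒marked x∈J) (J⇒marked y∈J)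

    J-closed : Closed T (J T s D)
    J-closed a₀ v b₀ c x∈J y∈J = ⊥-elim (marked-not-composable (Mem-marked x∈J) (Mem-marked y∈J) (a₀ , v , b₀ , inj₁ refl , inj₁ refl , c))

    ∉J : ∀ {w} → Mem T (Compl T (J T s D)) w → J T s D w → ⊥
    ∉J (inj₁ (_ , w∉J)) w∈J = w∉J (inj₁ w∈J)
    ∉J {w} (inj₂ (_ , w∉J)) w∈J = w∉J (inj₂ (subst (J T s D) (sym (reverse-involutive w)) w∈J))

    -- if the composite [i , i+j] of x and y lies in J, cut at the joint p: a head
    -- mark at p puts [i , p] in J , a tail mark puts [p , i+j] in J
    complement-closed : Closed T (Compl T (J T s D))
    complement-closed a₀ v b₀ (x-seg , y-seg , _ , xy-seg) x∉J y∉J = inj₁ (xy-seg , xy∉J)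
      where
      |a₀|≥1 : 1 ≤ length a₀
      |a₀|≥1 = ≤-pred (subst (2 ≤_) (trans (length-++ a₀ {v ∷ []}) (+-comm (length a₀) 1)) (proj₁ x-seg))
      xy∉J : ¬ Mem T (J T s D) (a₀ ++ v ∷ b₀)
      xy∉J xy∈J with Mem-marked xy∈J
      ... | i , j , j≥1 , lt , xy≈ , opens , closes with pieces i j |a₀|≥1 (≤-pred (proj₁ y-seg)) xy≈
      ...   | q , r , q≥1 , r≥1 , q+r≡j , orders = cut (some-mark (i + q) int) orders
        where
        i+q+r≡ : (i + q) + r ≡ i + j
        i+q+r≡ = trans (+-assoc i q r) (cong (i +_) q+r≡j)
        int : Interior (i + q)
        int = interior-end i q r q≥1 r≥1 (subst (_< L) (sym i+q+r≡) lt)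
        left∈J : ∀ {w} → SameSeg w (sub i q) → HeadMark (i + q) → J T s D w
        left∈J w≈ hm = marked⇒J (i , q , q≥1 , m<n⇒m<1+n (proj₂ int) , w≈ , opens , inj₂ hm)
        right∈J : ∀ {w} → SameSeg w (sub (i + q) r) → TailMark (i + q) → J T s D w
        right∈J w≈ tm = marked⇒J (i + q , r , r≥1 , subst (_< L) (sym i+q+r≡) lt , w≈ , inj₂ tm , subst Closes (sym i+q+r≡) closes)
        cut : HeadMark (i + q) ⊎ TailMark (i + q)
            → (SameSeg (a₀ ∷ʳ v) (sub i q) × SameSeg (v ∷ b₀) (sub (i + q) r))
              ⊎ (SameSeg (a₀ ∷ʳ v) (sub (i + q) r) × SameSeg (v ∷ b₀) (sub i q)) → ⊥
        cut (inj₁ hm) (inj₁ (x≈ , _))  = ∉J x∉J (left∈J x≈ hm)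
        cut (inj₁ hm) (inj₂ (_ , y≈))  = ∉J y∉J (left∈J y≈ hm)
        cut (inj₂ tm) (inj₁ (_ , y≈))  = ∉J y∉J (right∈J y≈ tm)
        cut (inj₂ tm) (inj₂ (x≈ , _))  = ∉J x∉J (right∈J x≈ tm)

lemma3p6 : ∀ {n : ℕ} (T : PlaneTree n) (s : List (Fin n)) (D : List (List (Fin n)))
    → IsLabel T s D
    → Biclosed T (J T s D)
    × (∀ x y → J T s D x → J T s D y → ¬ Composable T x y)
lemma3p6 T [] D label with proj₁ (proj₁ label)
... | ()
lemma3p6 T (v₀ ∷ rest) D label = (J-closed , complement-closed) , J-not-composable
  where open Intervals.Marking T v₀ rest (proj₁ label) D label
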